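{- For every integer $r>0$, there exists an $r$-strong eulerian digraph $D$ which has no strong $2$-partition; that is, there is no partition $(V_1,V_2)$ of $V(D)$ such that $B_D(V_1,V_2)$ is strongly connected.
   Context: For a partition $(V_1,V_2)$ of $V(D)$, $B_D(V_1,V_2)$ is the spanning subdigraph of $D$ whose arcs are those arcs of $D$ with one end in $V_1$ and the other in $V_2$. A digraph is strong (strongly connected) if for every ordered pair $u,v$ of distinct vertices there is a directed $(u,v)$-path; it is $r$-strong if $D-S$ is strong for every set $S$ of fewer than $r$ vertices. A digraph is eulerian if it is connected and every vertex has in-degree equal to its out-degree. -}

module Defs where

open import Data.Nat using (ℕ; zero; suc; _+_; _<_; _≤_)
open import Data.Fin using (Fin; zero; suc)
open import Data.Bool using (Bool; true; false; T; if_then_else_; not; _∧_; _∨_; _xor_)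
open import Data.Product using (Σ; ∃; _×_; _,_)
open import Data.Sum using (_⊎_)
open import Relation.Nullary using (¬_)
open import Relation.Binary.PropositionalEquality using (_≡_; _≢_)

record Digraph (n : ℕ) : Set where
  field
    arc      : Fin n → Fin n → Bool
    loopless : ∀ v → arc v v ≡ false
open Digraph public

sumFin : ∀ {n} → (Fin n → ℕ) → ℕ
sumFin {zero}  f = 0
sumFin {suc n} f = f zero + sumFin (λ i → f (suc i))

card : ∀ {n} → (Fin n → Bool) → ℕ
card S = sumFin (λ i → if S i then 1 else 0)

outdeg indeg : ∀ {n} → Digraph n → Fin n → ℕ
outdeg D v = sumFin (λ w → if arc D v w then 1 else 0)
indeg  D v = sumFin (λ w → if arc D w v then 1 else 0)

-- Directed walks using only arcs of the relation R and vertices in the set K.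
-- (A directed (u,v)-path exists iff a directed (u,v)-walk exists.)
data Walk {n : ℕ} (R : Fin n → Fin n → Bool) (K : Fin n → Bool)
          : Fin n → Fin n → Set where
  here : ∀ {u} → T (K u) → Walk R K u u
  step : ∀ {u w v} → T (K u) → T (R u w) → Walk R K w v → Walk R K u v

StrongOn : ∀ {n} → (Fin n → Fin n → Bool) → (Fin n → Bool) → Set
StrongOn R K = ∀ u v → T (K u) → T (K v) → u ≢ v → Walk R K u v

allV : ∀ {n} → Fin n → Bool
allV _ = true

Strong : ∀ {n} → Digraph n → Set
Strong D = StrongOn (arc D) allV

RStrong : ∀ {n} → ℕ → Digraph n → Set
RStrong {n} r D =
  suc r ≤ n × (∀ (S : Fin n → Bool) → card S < r → StrongOn (arc D) (λ v → not (S v)))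

Connected : ∀ {n} → Digraph n → Set
Connected D = StrongOn (λ u v → arc D u v ∨ arc D v u) allV

Eulerian : ∀ {n} → Digraph n → Set
Eulerian D = Connected D × (∀ v → indeg D v ≡ outdeg D v)

-- A partition (V₁,V₂) of V(D) given by P: V₁ = {v | P v = true},
-- V₂ = {v | P v = false}, both parts nonempty.
IsPartition : ∀ {n} → (Fin n → Bool) → Set
IsPartition P = (∃ λ v → P v ≡ true) × (∃ λ v → P v ≡ false)

bipArc : ∀ {n} → Digraph n → (Fin n → Bool) → Fin n → Fin n → Bool
bipArc D P u v = arc D u v ∧ (P u xor P v)

HasStrong2Partition : ∀ {n} → Digraph n → Set
HasStrong2Partition {n} D =
  Σ (Fin n → Bool) λ P → IsPartition P × StrongOn (bipArc D P) allV

-- For r > 0 let G r be the digraph on 2r+1 vertices z, x₁,…,x_r, y₁,…,y_r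
-- with arcs x_i → z, z → y_j, y_j → x_i (all i, j) and x_i → y_j (i ≠ j).
--
--  * Every vertex has in- and out-degree r (a counting argument over the
--    three kinds of vertices), so G r is eulerian once it is connected.
--  * Deleting fewer than r vertices leaves some x and some y, and for every
--    index i either z survives or some y_j (resp. x_j) with j ≠ i survives
--    (pigeonhole); from this explicit walks between surviving vertices are
--    built, so G r is r-strong, and in particular strong and connected.
--  * For a partition P, the set C of vertices x_i on the side of z and
--    vertices y_j on the other side is closed under the arcs of
--    B_D(V₁,V₂), avoids z, and contains every B-out-neighbour of z.  A
--    B-walk z → x₁ → z would therefore put z in C, so B is not strong.
module Submission where

open import Defs
open import Data.Nat using (ℕ; _>_; zero; suc; _+_; _≤_; _<_; s≤s; s≤s⁻¹)
open import Data.Nat.Properties using (≤-trans; ≤-<-trans; m≤m+n; m≤n+m; +-assoc; +-identityʳ)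
open import Data.Fin using (Fin; zero; suc; splitAt; _↑ˡ_; _↑ʳ_)
open import Data.Fin.Properties using (_≟_; suc-injective; splitAt-↑ˡ; splitAt-↑ʳ; splitAt⁻¹-↑ˡ; splitAt⁻¹-↑ʳ)
open import Data.Bool using (Bool; true; false; T; if_then_else_; not; _xor_)
open import Data.Bool.Properties using (T-∧; T-∨; T-not-≡; not-involutive; xor-same)
open import Data.Product using (Σ; ∃; _×_; _,_; proj₁; proj₂)
open import Data.Sum using (_⊎_; inj₁; inj₂; [_,_]′)
open import Data.Empty using (⊥-elim)
open import Data.Unit using (tt)
open import Function using (_∘_)
open import Function.Bundles using (Equivalence)
open import Relation.Nullary using (¬_; does)
open import Relation.Nullary.Decidable using (dec-false)
open import Relation.Binary.PropositionalEquality

module _ {n : ℕ} where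

  _++ʷ_ : ∀ {R : Fin n → Fin n → Bool} {K : Fin n → Bool} {u w v} →
          Walk R K u w → Walk R K w v → Walk R K u v
  here _       ++ʷ q = q
  step k a p   ++ʷ q = step k a (p ++ʷ q)

  walk-map : ∀ {R R' : Fin n → Fin n → Bool} {K : Fin n → Bool} {u v} →
             (∀ a b → T (R a b) → T (R' a b)) → Walk R K u v → Walk R' K u v
  walk-map f (here k)     = here k
  walk-map f (step k a p) = step k (f _ _ a) (walk-map f p)

  Closed : (Fin n → Fin n → Bool) → (Fin n → Bool) → Set
  Closed R C = ∀ u v → T (R u v) → T (C u) → T (C v)

  walk-stays : ∀ {R K C u v} → Closed R C → Walk R K u v → T (C u) → T (C v)
  walk-stays cl (here _)     c = c
  walk-stays cl (step _ a p) c = walk-stays cl p (cl _ _ a c)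

  walk-leaves : ∀ {R K C u v} → Closed R C → (∀ w → T (R u w) → T (C w)) →
                Walk R K u v → u ≢ v → T (C v)
  walk-leaves cl out (here _)     u≢v = ⊥-elim (u≢v refl)
  walk-leaves cl out (step _ a p) _   = walk-stays cl p (out _ a)

indicator : Bool → ℕ
indicator b = if b then 1 else 0

sumFin-cong : ∀ {m} {f g : Fin m → ℕ} → (∀ i → f i ≡ g i) → sumFin f ≡ sumFin g
sumFin-cong {zero}  f≡g = refl
sumFin-cong {suc m} f≡g = cong₂ _+_ (f≡g zero) (sumFin-cong (f≡g ∘ suc))

sumFin-split : ∀ m {n} (f : Fin (m + n) → ℕ) →
               sumFin f ≡ sumFin (λ i → f (i ↑ˡ n)) + sumFin (λ j → f (m ↑ʳ j))
sumFin-split zero    f = refl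
sumFin-split (suc m) f =
  trans (cong (f zero +_) (sumFin-split m (f ∘ suc))) (sym (+-assoc (f zero) _ _))

sumFin-zero : ∀ {m} → sumFin {m} (λ _ → 0) ≡ 0
sumFin-zero {zero}  = refl
sumFin-zero {suc m} = sumFin-zero {m}

sumFin-one : ∀ {m} → sumFin {m} (λ _ → 1) ≡ m
sumFin-one {zero}  = refl
sumFin-one {suc m} = cong suc (sumFin-one {m})

card-others : ∀ {m} (i : Fin m) → suc (card (λ j → not (does (i ≟ j)))) ≡ m
card-others {suc m} zero    = cong suc sumFin-one
card-others {suc m} (suc i) = cong suc (card-others i)

card-others′ : ∀ {m} (j : Fin m) → suc (card (λ i → not (does (i ≟ j)))) ≡ m
card-others′ {suc m} zero    = cong suc sumFin-one
card-others′ {suc m} (suc j) = cong suc (card-others′ j)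

pigeonhole : ∀ {m} (f : Fin m → Bool) → card f < m → ∃ λ j → f j ≡ false
pigeonhole {suc m} f small with f zero in e
... | false = zero , e
... | true with pigeonhole (f ∘ suc) (s≤s⁻¹ small)
...   | j , p = suc j , p

pigeonhole-avoiding : ∀ {m} (f : Fin m → Bool) (i : Fin m) → suc (card f) < m →
                      ∃ λ j → i ≢ j × f j ≡ false
pigeonhole-avoiding {suc m} f zero small
  with pigeonhole (f ∘ suc) (≤-<-trans (m≤n+m _ (indicator (f zero))) (s≤s⁻¹ small))
... | j , p = suc j , (λ ()) , p
pigeonhole-avoiding {suc m} f (suc i) small with f zero in e
... | false = zero , (λ ()) , e
... | true with pigeonhole-avoiding (f ∘ suc) i (s≤s⁻¹ small)
...   | j , i≢j , p = suc j , i≢j ∘ suc-injective , p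

-- An r-strong digraph (r > 0) is strong: delete the empty set.
rstrong⇒strong : ∀ {n r} {D : Digraph n} → r > 0 → RStrong r D → Strong D
rstrong⇒strong {n} 0<r (_ , strongAfter) =
  strongAfter (λ _ → false) (subst (_< _) (sym (sumFin-zero {n})) 0<r)

strong⇒connected : ∀ {n} {D : Digraph n} → Strong D → Connected D
strong⇒connected st u v ku kv u≢v =
  walk-map (λ _ _ a → Equivalence.from T-∨ (inj₁ a)) (st u v ku kv u≢v)

data Kind (r : ℕ) : Set where
  z   : Kind r
  x y : Fin r → Kind r

arcK : ∀ {r} → Kind r → Kind r → Bool
arcK z     z     = false
arcK z     (x _) = false
arcK z     (y _) = true
arcK (x _) z     = true
arcK (x _) (x _) = false
arcK (x i) (y j) = not (does (i ≟ j))
arcK (y _) z     = false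
arcK (y _) (x _) = true
arcK (y _) (y _) = false

arcK-loopless : ∀ {r} (a : Kind r) → arcK a a ≡ false
arcK-loopless z     = refl
arcK-loopless (x i) = refl
arcK-loopless (y i) = refl

arcK-x-y : ∀ {r} {i j : Fin r} → i ≢ j → T (arcK (x i) (y j))
arcK-x-y {i = i} {j} i≢j = Equivalence.from T-not-≡ (dec-false (i ≟ j) i≢j)

module _ {r : ℕ} where

  kind : Fin (suc (r + r)) → Kind r
  kind zero    = z
  kind (suc w) = [ x , y ]′ (splitAt r w)

  vertex : Kind r → Fin (suc (r + r))
  vertex z     = zero
  vertex (x i) = suc (i ↑ˡ r)
  vertex (y j) = suc (r ↑ʳ j)

  kind-vertex : ∀ a → kind (vertex a) ≡ a
  kind-vertex z     = refl
  kind-vertex (x i) = cong [ x , y ]′ (splitAt-↑ˡ r i r)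
  kind-vertex (y j) = cong [ x , y ]′ (splitAt-↑ʳ r r j)

  vertex-kind : ∀ v → v ≡ vertex (kind v)
  vertex-kind zero    = refl
  vertex-kind (suc w) = from-split w (splitAt r w) refl
    where
    from-split : ∀ w s → splitAt r w ≡ s → suc w ≡ vertex ([ x , y ]′ s)
    from-split w (inj₁ i) eq = cong suc (sym (splitAt⁻¹-↑ˡ eq))
    from-split w (inj₂ j) eq = cong suc (sym (splitAt⁻¹-↑ʳ eq))

  sumFin-vertices : (f : Fin (suc (r + r)) → ℕ) →
    sumFin f ≡ f (vertex z) + (sumFin (f ∘ vertex ∘ x) + sumFin (f ∘ vertex ∘ y))
  sumFin-vertices f = cong (f zero +_) (sumFin-split r (f ∘ suc))

  sumFin-kinds : (h : Kind r → ℕ) →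
    sumFin (h ∘ kind) ≡ h z + (sumFin (h ∘ x) + sumFin (h ∘ y))
  sumFin-kinds h = trans (sumFin-vertices (h ∘ kind))
    (cong (h z +_) (cong₂ _+_ (sumFin-cong (cong h ∘ kind-vertex ∘ x))
                              (sumFin-cong (cong h ∘ kind-vertex ∘ y))))

G : (r : ℕ) → Digraph (suc (r + r))
G r = record
  { arc      = λ u v → arcK (kind {r} u) (kind {r} v)
  ; loopless = λ v → arcK-loopless (kind {r} v)
  }

module _ {r : ℕ} where

  outdeg-G : ∀ v → outdeg (G r) v ≡ r
  outdeg-G v = trans (sumFin-kinds {r} (indicator ∘ arcK (kind {r} v))) (out-kind (kind {r} v))
    where
    out-kind : ∀ a → indicator (arcK a z) +
      (sumFin (indicator ∘ arcK a ∘ x) + sumFin (indicator ∘ arcK a ∘ y)) ≡ r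
    out-kind z     = cong₂ _+_ (sumFin-zero {r}) sumFin-one
    out-kind (x i) = trans (cong (λ k → suc (k + card (λ j → not (does (i ≟ j))))) (sumFin-zero {r}))
                           (card-others i)
    out-kind (y j) = trans (cong₂ _+_ sumFin-one (sumFin-zero {r})) (+-identityʳ r)

  indeg-G : ∀ v → indeg (G r) v ≡ r
  indeg-G v = trans (sumFin-kinds {r} (λ a → indicator (arcK a (kind {r} v)))) (in-kind (kind {r} v))
    where
    in-kind : ∀ b → indicator (arcK z b) +
      (sumFin (λ i → indicator (arcK (x i) b)) + sumFin (λ j → indicator (arcK (y j) b))) ≡ r
    in-kind z     = trans (cong₂ _+_ sumFin-one (sumFin-zero {r})) (+-identityʳ r)
    in-kind (x i) = cong₂ _+_ (sumFin-zero {r}) sumFin-one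
    in-kind (y j) = trans (cong (λ k → suc (others + k)) (sumFin-zero {r}))
                   (trans (cong suc (+-identityʳ others)) (card-others′ j))
      where
      others : ℕ
      others = card (λ i → not (does (i ≟ j)))

module SurvivorsConnected {r : ℕ} (S : Fin (suc (r + r)) → Bool) (small : card S < r) where

  -- A vertex kind that survives the deletion (a record, so that its index
  -- can be inferred).
  record Kept (a : Kind r) : Set where
    constructor kept
    field survives : T (not (S (vertex a)))
  open Kept

  Path : Kind r → Kind r → Set
  Path a b = Walk (arc (G r)) (not ∘ S) (vertex a) (vertex b)

  edge : ∀ {a b} → Kept a → T (arcK a b) → Kept b → Path a b
  edge {a} {b} ka ab kb = step (survives ka) arc-vertex (here (survives kb))
    where
    arc-vertex : T (arc (G r) (vertex a) (vertex b))
    arc-vertex = subst₂ (λ (c d : Kind r) → T (arcK c d))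
                        (sym (kind-vertex a)) (sym (kind-vertex b)) ab

  deletedX deletedY : ℕ
  deletedX = card (S ∘ vertex {r} ∘ x)
  deletedY = card (S ∘ vertex {r} ∘ y)

  bound : indicator (S zero) + (deletedX + deletedY) < r
  bound = subst (_< r) (sumFin-vertices {r} (indicator ∘ S)) small

  hub-deleted : S zero ≡ true → suc deletedX < r × suc deletedY < r
  hub-deleted e = ≤-<-trans (s≤s (m≤m+n deletedX deletedY)) bound′
                , ≤-<-trans (s≤s (m≤n+m deletedY deletedX)) bound′
    where
    bound′ : suc (deletedX + deletedY) < r
    bound′ = subst (λ b → indicator b + (deletedX + deletedY) < r) e bound

  not-deleted : ∀ {a} → S (vertex a) ≡ false → Kept a
  not-deleted = kept ∘ Equivalence.from T-not-≡

  hub-kept-or-deleted : Kept z ⊎ S zero ≡ true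
  hub-kept-or-deleted = by-cases (S zero) refl
    where
    by-cases : ∀ b → S zero ≡ b → Kept z ⊎ S zero ≡ true
    by-cases false e = inj₁ (not-deleted e)
    by-cases true  e = inj₂ e

  few-deleted : deletedX < r × deletedY < r
  few-deleted = ≤-<-trans (≤-trans (m≤m+n deletedX deletedY) both) bound
              , ≤-<-trans (≤-trans (m≤n+m deletedY deletedX) both) bound
    where
    both : deletedX + deletedY ≤ indicator (S zero) + (deletedX + deletedY)
    both = m≤n+m (deletedX + deletedY) (indicator (S zero))

  kept-x : ∃ λ i → Kept (x i)
  kept-x with pigeonhole (S ∘ vertex {r} ∘ x) (proj₁ few-deleted)
  ... | i , p = i , not-deleted p

  kept-y : ∃ λ j → Kept (y j)
  kept-y with pigeonhole (S ∘ vertex {r} ∘ y) (proj₂ few-deleted)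
  ... | j , p = j , not-deleted p

  kept-z-or-y : ∀ i → Kept z ⊎ ∃ λ j → i ≢ j × Kept (y j)
  kept-z-or-y i with hub-kept-or-deleted
  ... | inj₁ kz = inj₁ kz
  ... | inj₂ e with pigeonhole-avoiding (S ∘ vertex {r} ∘ y) i (proj₂ (hub-deleted e))
  ...   | j , i≢j , p = inj₂ (j , i≢j , not-deleted p)

  kept-z-or-x : ∀ j → Kept z ⊎ ∃ λ i → i ≢ j × Kept (x i)
  kept-z-or-x j with hub-kept-or-deleted
  ... | inj₁ kz = inj₁ kz
  ... | inj₂ e with pigeonhole-avoiding (S ∘ vertex {r} ∘ x) j (proj₁ (hub-deleted e))
  ...   | i , j≢i , p = inj₂ (i , ≢-sym j≢i , not-deleted p)

  reach-y : ∀ a → Kept a → ∃ λ j → Kept (y j) × Path a (y j)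
  reach-y z     kz = let (j , kj) = kept-y in j , kj , edge kz tt kj
  reach-y (y j) kj = j , kj , here (survives kj)
  reach-y (x i) ki with kept-z-or-y i
  ... | inj₁ kz = let (j , kj) = kept-y in j , kj , (edge ki tt kz ++ʷ edge kz tt kj)
  ... | inj₂ (j , i≢j , kj) = j , kj , edge ki (arcK-x-y i≢j) kj

  to-x : ∀ a i → Kept a → Kept (x i) → Path a (x i)
  to-x a i ka ki = let (j , kj , p) = reach-y a ka in p ++ʷ edge kj tt ki

  to-z : ∀ a → Kept a → Kept z → Path a z
  to-z z     _  kz = here (survives kz)
  to-z (x i) ki kz = edge ki tt kz
  to-z (y j) kj kz = let (i , ki) = kept-x in edge kj tt ki ++ʷ edge ki tt kz

  to-y : ∀ a j → Kept a → Kept (y j) → Path a (y j)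
  to-y a j ka kj with kept-z-or-x j
  ... | inj₁ kz = to-z a ka kz ++ʷ edge kz tt kj
  ... | inj₂ (i , i≢j , ki) = to-x a i ka ki ++ʷ edge ki (arcK-x-y i≢j) kj

  path : ∀ a b → Kept a → Kept b → Path a b
  path a z     = to-z a
  path a (x i) = to-x a i
  path a (y j) = to-y a j

  strong : StrongOn (arc (G r)) (not ∘ S)
  strong u v ku kv _ =
    subst₂ (Walk (arc (G r)) (not ∘ S)) (sym (vertex-kind {r} u)) (sym (vertex-kind {r} v))
      (path (kind {r} u) (kind {r} v) (kept (subst (T ∘ not ∘ S) (vertex-kind {r} u) ku))
                                      (kept (subst (T ∘ not ∘ S) (vertex-kind {r} v) kv)))

G-rstrong : ∀ r → RStrong r (G r)
G-rstrong r = s≤s (m≤m+n r r) , SurvivorsConnected.strong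

-- Crossing an arc of B_D(V₁,V₂) flips the side relative to any fixed vertex.
xor-flip : ∀ a b c → T (a xor b) → b xor c ≡ not (a xor c)
xor-flip true  false c _ = sym (not-involutive c)
xor-flip false true  c _ = refl
xor-flip true  true  c ()
xor-flip false false c ()

module ClosedSet {r : ℕ} (P : Fin (suc (r + r)) → Bool) where

  -- side a: whether a lies in the part not containing z.
  side : Kind r → Bool
  side a = P (vertex a) xor P zero

  inC : Kind r → Bool
  inC z     = false
  inC (x i) = not (side (x i))
  inC (y j) = side (y j)

  C : Fin (suc (r + r)) → Bool
  C = inC ∘ kind {r}

  side-flip : ∀ a b → T (P (vertex a) xor P (vertex b)) → side b ≡ not (side a)
  side-flip a b = xor-flip (P (vertex a)) (P (vertex b)) (P zero)

  -- C is closed under B-arcs; only the arcs x → z, x → y and y → x need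
  -- an argument (an arc x_i → z of B would put x_i on the other side of z).
  inC-closed : ∀ a b → T (arcK a b) → T (P (vertex a) xor P (vertex b)) → T (inC a) → T (inC b)
  inC-closed (x i) z     _ ab c = ⊥-elim (subst T (trans (sym (side-flip (x i) z ab)) (xor-same (P zero))) c)
  inC-closed (x i) (y j) _ ab c = subst T (sym (side-flip (x i) (y j) ab)) c
  inC-closed (y j) (x i) _ ab c =
    subst T (sym (trans (cong not (side-flip (y j) (x i) ab)) (not-involutive _))) c

  -- The B-out-neighbours of z are y's on the other side, hence in C.
  inC-out-of-z : ∀ b → T (arcK z b) → T (P zero xor P (vertex b)) → T (inC b)
  inC-out-of-z (y j) _ zb = subst T (sym (trans (side-flip z (y j) zb) (cong not (xor-same (P zero))))) tt

  crossing : ∀ u v → T (bipArc (G r) P u v) →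
             T (arcK (kind {r} u) (kind {r} v)) × T (P (vertex (kind {r} u)) xor P (vertex (kind {r} v)))
  crossing u v uv with Equivalence.to T-∧ uv
  ... | a , p = a , subst₂ (λ p q → T (p xor q)) (cong P (vertex-kind {r} u)) (cong P (vertex-kind {r} v)) p

  closed : Closed (bipArc (G r) P) C
  closed u v uv = let (a , p) = crossing u v uv in inC-closed (kind {r} u) (kind {r} v) a p

  out-of-z : ∀ w → T (bipArc (G r) P zero w) → T (C w)
  out-of-z w zw = let (a , p) = crossing zero w zw in inC-out-of-z (kind {r} w) a p

-- A strong B would give B-walks z → x₁ and x₁ → z, putting z into C.
G-no-strong-2-partition : ∀ r → r > 0 → ¬ HasStrong2Partition (G r)
G-no-strong-2-partition (suc r) _ (P , _ , strongB) =
  walk-stays closed (strongB x₁ zero tt tt (λ ()))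
    (walk-leaves closed out-of-z (strongB zero x₁ tt tt (λ ())) (λ ()))
  where
  open ClosedSet {suc r} P
  x₁ : Fin (suc (suc r + suc r))
  x₁ = vertex (x zero)

theorem7p1 : ∀ (r : ℕ) → r > 0 →
    Σ ℕ λ n → Σ (Digraph n) λ D →
      RStrong r D × Eulerian D × ¬ HasStrong2Partition D
theorem7p1 r r>0 =
  suc (r + r) , G r , G-rstrong r , eulerian , G-no-strong-2-partition r r>0
  where
  eulerian : Eulerian (G r)
  eulerian = strong⇒connected {D = G r} (rstrong⇒strong {D = G r} r>0 (G-rstrong r))
           , λ v → trans (indeg-G {r} v) (sym (outdeg-G {r} v))
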